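{- There exists a language which is context-free and definable in Presburger arithmetic, yet does not have subexponential alternating online state complexity, i.e. it is not in $\mathrm{Alt}(f)$ for any $f:\mathbb{N}\to\mathbb{N}$ satisfying $f = o(C^n)$ for all $C>1$.
   Context: An alternating machine over a finite alphabet $A$ consists of a (possibly infinite) set of states $Q$, an initial state $q_0\in Q$, a transition function $\delta: Q\times A\to\mathcal{B}^+(Q)$ (positive boolean formulae over $Q$) and a set $F\subseteq Q$ of accepting states. For an input word $w$, the acceptance game $\mathcal{G}_{\mathcal{A},w}$ is played by Prover and Verifier: starting in $q_0$, the letters of $w$ are read from left to right; in state $q$ reading letter $a$, the next state is obtained from the formula $\delta(q,a)$, Prover resolving disjunctions and Verifier resolving conjunctions. Prover wins a play if it ends in a state of $F$. The word $w$ is accepted if Prover has a winning strategy; the language recognised is the set of accepted words. For $f:\mathbb{N}\to\mathbb{N}$, a language $L$ is in $\mathrm{Alt}(f)$ if there are an alternating machine recognising $L$ and a constant $C$ such that for all $n\in\mathbb{N}$, the number of states $q$ for which there exists a word $w$ of length at most $n$ with $q$ appearing in the game $\mathcal{G}_{\mathcal{A},w}$ is at most $C\cdot f(n)$. -}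

module Defs where

open import Data.Nat using (ℕ; zero; suc; _+_; _*_; _^_; _≤_; _<_; _≥_)
open import Data.Fin using (Fin)
open import Data.List using (List; []; _∷_; _++_; length)
open import Data.List.Membership.Propositional using (_∈_)
open import Data.Maybe using (Maybe; just; nothing)
open import Data.Product using (Σ; ∃; _×_; _,_)
open import Data.Sum using (_⊎_; inj₁; inj₂)
open import Data.Unit using (⊤)
open import Data.Empty using (⊥)
open import Data.Vec.Functional using () renaming (_∷_ to _∷ᵥ_)
open import Relation.Nullary using (¬_)
open import Relation.Binary.PropositionalEquality using (_≡_)
open import Function.Bundles using (_⇔_)

Language : ℕ → Set₁
Language k = List (Fin k) → Set

data BF (Q : Set) : Set where
  atom : Q → BF Q
  true false : BF Q
  _∧_ _∨_ : BF Q → BF Q → BF Q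

-- value of a formula when atom q is worth V q
-- (Prover resolves ∨, Verifier resolves ∧)
evalBF : {Q : Set} → (Q → Set) → BF Q → Set
evalBF V (atom q) = V q
evalBF V true = ⊤
evalBF V false = ⊥
evalBF V (φ ∧ ψ) = evalBF V φ × evalBF V ψ
evalBF V (φ ∨ ψ) = evalBF V φ ⊎ evalBF V ψ

-- q occurs as an atom in φ (i.e. can be chosen as next state in the game)
data OccursIn {Q : Set} (q : Q) : BF Q → Set where
  here  : OccursIn q (atom q)
  ∧ˡ : ∀ {φ ψ} → OccursIn q φ → OccursIn q (φ ∧ ψ)
  ∧ʳ : ∀ {φ ψ} → OccursIn q ψ → OccursIn q (φ ∧ ψ)
  ∨ˡ : ∀ {φ ψ} → OccursIn q φ → OccursIn q (φ ∨ ψ)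
  ∨ʳ : ∀ {φ ψ} → OccursIn q ψ → OccursIn q (φ ∨ ψ)

record AltMachine (k : ℕ) : Set₁ where
  field
    Q     : Set
    q₀    : Q
    δ     : Q → Fin k → BF Q
    Final : Q → Set

module _ {k : ℕ} (M : AltMachine k) where
  open AltMachine M

  Wins : Q → List (Fin k) → Set
  Wins q []      = Final q
  Wins q (a ∷ w) = evalBF (λ q' → Wins q' w) (δ q a)

  Accepts : List (Fin k) → Set
  Accepts w = Wins q₀ w

  data AppearsFrom : Q → List (Fin k) → Q → Set where
    start : ∀ {q w} → AppearsFrom q w q
    step  : ∀ {q a w q'' q'} → OccursIn q'' (δ q a) → AppearsFrom q'' w q' →
            AppearsFrom q (a ∷ w) q'

  AppearsIn : List (Fin k) → Q → Set
  AppearsIn w q = AppearsFrom q₀ w q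

Recognises : {k : ℕ} → AltMachine k → Language k → Set
Recognises M L = ∀ w → L w ⇔ Accepts M w

StatesBound : {k : ℕ} → AltMachine k → ℕ → ℕ → Set
StatesBound M n b =
  Σ (List (AltMachine.Q M)) λ xs → length xs ≤ b ×
    (∀ q → (Σ (List _) λ w → length w ≤ n × AppearsIn M w q) → q ∈ xs)

InAlt : {k : ℕ} → (ℕ → ℕ) → Language k → Set₁
InAlt {k} f L = Σ (AltMachine k) λ M → Recognises M L ×
  Σ ℕ λ C → ∀ n → StatesBound M n (C * f n)

-- f = o(Cⁿ) for every real C > 1.  Equivalently (rational C = p/q suffices,
-- and ε = 1/m suffices): for all p > q ≥ 1 and m ≥ 1 there is N with
-- f(n) ≤ (1/m)(p/q)ⁿ, i.e. m * f(n) * qⁿ ≤ pⁿ, for all n ≥ N.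
Subexponential : (ℕ → ℕ) → Set
Subexponential f = ∀ p q m → 1 ≤ q → q < p → 1 ≤ m →
  Σ ℕ λ N → ∀ n → N ≤ n → m * f n * q ^ n ≤ p ^ n

record CFG (k : ℕ) : Set where
  field
    nonterminals : ℕ
    startSymbol : Fin nonterminals
    rules : List (Fin nonterminals × List (Fin nonterminals ⊎ Fin k))

module _ {k : ℕ} (G : CFG k) where
  open CFG G
  Symbol = Fin nonterminals ⊎ Fin k

  mutual
    data Derives : Symbol → List (Fin k) → Set where
      terminal : ∀ a → Derives (inj₂ a) (a ∷ [])
      rule     : ∀ {X rhs w} → (X , rhs) ∈ rules → DerivesSeq rhs w →
                 Derives (inj₁ X) w

    data DerivesSeq : List Symbol → List (Fin k) → Set where
      []  : DerivesSeq [] []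
      _∷_ : ∀ {s ss u v} → Derives s u → DerivesSeq ss v →
            DerivesSeq (s ∷ ss) (u ++ v)

  Generates : List (Fin k) → Set
  Generates w = Derives (inj₁ startSymbol) w

ContextFree : {k : ℕ} → Language k → Set
ContextFree {k} L = Σ (CFG k) λ G → ∀ w → L w ⇔ Generates G w

data PForm (k : ℕ) : ℕ → Set where
  plus   : ∀ {v} → Fin v → Fin v → Fin v → PForm k v
  equal  : ∀ {v} → Fin v → Fin v → PForm k v
  less   : ∀ {v} → Fin v → Fin v → PForm k v
  letter : ∀ {v} → Fin k → Fin v → PForm k v
  neg    : ∀ {v} → PForm k v → PForm k v
  and or : ∀ {v} → PForm k v → PForm k v → PForm k v
  exists all : ∀ {v} → PForm k (suc v) → PForm k v

letterAt : {k : ℕ} → List (Fin k) → ℕ → Maybe (Fin k)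
letterAt []      _       = nothing
letterAt (a ∷ w) zero    = just a
letterAt (a ∷ w) (suc i) = letterAt w i

Sat : {k v : ℕ} → List (Fin k) → (Fin v → ℕ) → PForm k v → Set
Sat w ρ (plus x y z)  = ρ x + ρ y ≡ ρ z
Sat w ρ (equal x y)   = ρ x ≡ ρ y
Sat w ρ (less x y)    = ρ x < ρ y
Sat w ρ (letter a x)  = letterAt w (ρ x) ≡ just a
Sat w ρ (neg φ)       = ¬ Sat w ρ φ
Sat w ρ (and φ ψ)     = Sat w ρ φ × Sat w ρ ψ
Sat w ρ (or φ ψ)      = Sat w ρ φ ⊎ Sat w ρ ψ
Sat w ρ (exists φ)    = Σ ℕ λ p → p < length w × Sat w (p ∷ᵥ ρ) φ
Sat w ρ (all φ)       = ∀ p → p < length w → Sat w (p ∷ᵥ ρ) φ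

noVars : Fin 0 → ℕ
noVars ()

PresburgerDefinable : {k : ℕ} → Language k → Set
PresburgerDefinable {k} L =
  Σ (PForm k 0) λ φ → ∀ w → L w ⇔ Sat w noVars φ

module Submission where

open import Defs
open import Data.Nat using (ℕ; zero; suc; _+_; _*_; _^_; _≤_; _<_; _∸_; z≤n; s≤s; _<?_)
open import Data.Nat.Properties
open import Data.Nat.Tactic.RingSolver using (solve-∀)
open import Data.Fin using (Fin; zero; suc; #_)
open import Data.Fin.Base using (finToFun; funToFin; combine)
open import Data.Fin.Properties
  using (pigeonhole; finToFun-funToFin; funToFin-finToFin) renaming (_≟_ to _≟ᶠ_; <-irrefl to <ᶠ-irrefl)
open import Data.List using (List; []; _∷_; _++_; length; reverse; lookup; allFin; [_]; map; filter; take; drop)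
open import Data.List.Properties
  using (++-assoc; ∷-injective; reverse-injective; length-reverse; length-++; unfold-reverse; ++-identityʳ;
         length-take; take++drop≡id; drop-drop)
open import Data.List.Relation.Unary.Any using (here; there; index)
open import Data.List.Relation.Unary.Any.Properties using (lookup-index; reverse⁻)
open import Data.List.Membership.Propositional using (_∈_; _∉_)
open import Data.List.Membership.Propositional.Properties
  using (∈-allFin; ∈-map⁺; ∈-map⁻; ∈-++⁺ˡ; ∈-++⁺ʳ; ∈-++⁻; ∈-filter⁺; ∈-filter⁻)
open import Data.Product using (Σ; _×_; _,_; proj₁; proj₂)
open import Data.Sum using (_⊎_; inj₁; inj₂)
open import Data.Empty using (⊥-elim)
open import Data.Maybe using (just; nothing)
open import Data.Maybe.Properties using (just-injective)
open import Relation.Nullary using (¬_; Dec; yes; no; contradiction)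
open import Relation.Nullary.Decidable using (¬¬-excluded-middle)
open import Relation.Binary.PropositionalEquality hiding ([_])
open import Function.Base using (_∘_)
open import Function.Bundles using (_⇔_; mk⇔; Equivalence)
open import Data.Vec.Functional using () renaming (_∷_ to _∷ᵥ_)

-- L = { u # y $ uᴿ z }.  It is generated by the grammar below, and it is Presburger
-- definable by guessing the positions h of # and d of $ and requiring w[d + h − i] = w[i]
-- for all i < h.  For the lower bound, let r range over the 2^N binary words of length N
-- and S over the sets of such words; let pᵣ = r # and let s_S concatenate the blocks
-- $ r'ᴿ for r' ∈ S.  Then pᵣ s_S ∈ L iff r ∈ S.  After reading any pᵣ the acceptance game
-- only visits states among the K ≤ C f(N+1) states of the bound, and whether pᵣ s_S is
-- accepted depends only on which of these K states win on s_S.  Hence S ↦ (that set of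
-- states) is injective, so 2^(2^N) ≤ 2^K; this contradicts C f(N+1) < 2^N, which
-- subexponential growth provides.

module _ {k : ℕ} (M : AltMachine k) where
  open AltMachine M

  evalBF-mono : ∀ {V V′ : Q → Set} (φ : BF Q) →
                (∀ q → OccursIn q φ → V q → V′ q) → evalBF V φ → evalBF V′ φ
  evalBF-mono (atom q) h x = h q here x
  evalBF-mono true h x = x
  evalBF-mono (φ ∧ ψ) h (x , y) =
    evalBF-mono φ (λ q o → h q (∧ˡ o)) x , evalBF-mono ψ (λ q o → h q (∧ʳ o)) y
  evalBF-mono (φ ∨ ψ) h (inj₁ x) = inj₁ (evalBF-mono φ (λ q o → h q (∨ˡ o)) x)
  evalBF-mono (φ ∨ ψ) h (inj₂ y) = inj₂ (evalBF-mono ψ (λ q o → h q (∨ʳ o)) y)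

  Wins-++-mono : ∀ q u {v v′} →
                 (∀ q′ → AppearsFrom M q u q′ → Wins M q′ v → Wins M q′ v′) →
                 Wins M q (u ++ v) → Wins M q (u ++ v′)
  Wins-++-mono q [] h x = h q start x
  Wins-++-mono q (a ∷ u) h x =
    evalBF-mono (δ q a) (λ q″ o → Wins-++-mono q″ u (λ q′ ap → h q′ (step o ap))) x

¬¬-∀-Fin : ∀ n {P : Fin n → Set} → (∀ i → ¬ ¬ P i) → ¬ ¬ (∀ i → P i)
¬¬-∀-Fin zero h k = k (λ ())
¬¬-∀-Fin (suc n) h k =
  h zero λ p₀ → ¬¬-∀-Fin n (λ i → h (suc i)) λ p → k λ { zero → p₀ ; (suc i) → p i }

decToBit : ∀ {A : Set} → Dec A → Fin 2
decToBit (yes _) = suc zero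
decToBit (no _)  = zero

decToBit-≡⇒→ : ∀ {A B : Set} (a? : Dec A) (b? : Dec B) → decToBit a? ≡ decToBit b? → A → B
decToBit-≡⇒→ (yes _) (yes b) _  _ = b
decToBit-≡⇒→ (no ¬a) _       _  a = ⊥-elim (¬a a)

Fin2-≡ : ∀ (a b : Fin 2) → (a ≡ suc zero → b ≡ suc zero) → (b ≡ suc zero → a ≡ suc zero) → a ≡ b
Fin2-≡ zero       zero       _ _ = refl
Fin2-≡ (suc zero) (suc zero) _ _ = refl
Fin2-≡ zero       (suc zero) _ g with () ← g refl
Fin2-≡ (suc zero) zero       f _ with () ← f refl

funToFin-cong : ∀ {m n} (f g : Fin m → Fin n) → (∀ i → f i ≡ g i) → funToFin f ≡ funToFin g
funToFin-cong {zero}  f g eq = refl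
funToFin-cong {suc m} f g eq =
  cong₂ combine (eq zero) (funToFin-cong (λ i → f (suc i)) (λ i → g (suc i)) (λ i → eq (suc i)))

finToFun-injective : ∀ {m n} (r r′ : Fin (m ^ n)) →
                     (∀ i → finToFun {m} {n} r i ≡ finToFun r′ i) → r ≡ r′
finToFun-injective {m} {n} r r′ eq = begin
  r                              ≡⟨ funToFin-finToFin {n} {m} r ⟨
  funToFin (finToFun {m} {n} r)  ≡⟨ funToFin-cong _ _ eq ⟩
  funToFin (finToFun {m} {n} r′) ≡⟨ funToFin-finToFin {n} {m} r′ ⟩
  r′                             ∎
  where open ≡-Reasoning

-- A subset S of Fin R is coded as S : Fin (2 ^ R) with characteristic function finToFun S.
module _ {k : ℕ} (M : AltMachine k) {L : Language k} (recognises : Recognises M L)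
         {n R : ℕ} (prefix : Fin R → List (Fin k)) (suffix : Fin (2 ^ R) → List (Fin k))
         (separates : ∀ r S → L (prefix r ++ suffix S) ⇔ finToFun S r ≡ suc zero) where
  open AltMachine M
  open Equivalence

  module Profiles (xs : List Q) (covers : ∀ r q → AppearsFrom M q₀ (prefix r) q → q ∈ xs)
                  (wins? : ∀ i S → Dec (Wins M (lookup xs i) (suffix S))) where

    profile : Fin (2 ^ R) → Fin (2 ^ length xs)
    profile S = funToFin λ i → decToBit (wins? i S)

    profile-≡⇒⊆ : ∀ S S′ → profile S ≡ profile S′ → ∀ r →
                     finToFun S r ≡ suc zero → finToFun S′ r ≡ suc zero
    profile-≡⇒⊆ S S′ eq r r∈S =
      to (separates r S′) (from (recognises _) (Wins-++-mono M q₀ (prefix r) transfer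
        (to (recognises _) (from (separates r S) r∈S))))
      where
      profile-≡-at : ∀ i → decToBit (wins? i S) ≡ decToBit (wins? i S′)
      profile-≡-at i = trans (sym (finToFun-funToFin _ i))
                   (trans (cong (λ c → finToFun c i) eq) (finToFun-funToFin _ i))
      transfer : ∀ q → AppearsFrom M q₀ (prefix r) q → Wins M q (suffix S) → Wins M q (suffix S′)
      transfer q ap with covers r q ap
      ... | q∈xs rewrite lookup-index q∈xs =
        decToBit-≡⇒→ (wins? (index q∈xs) S) (wins? (index q∈xs) S′) (profile-≡-at (index q∈xs))

    profile-injective : ∀ S S′ → profile S ≡ profile S′ → S ≡ S′
    profile-injective S S′ eq = finToFun-injective S S′ λ r →
      Fin2-≡ _ _ (profile-≡⇒⊆ S S′ eq r) (profile-≡⇒⊆ S′ S (sym eq) r)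

  fooling-set-bound : ∀ {b} → (∀ r → length (prefix r) ≤ n) → StatesBound M n b → R ≤ b
  fooling-set-bound short (xs , |xs|≤b , covers) = ≤-trans (≮⇒≥ |xs|≮R) |xs|≤b
    where
    covers′ : ∀ r q → AppearsFrom M q₀ (prefix r) q → q ∈ xs
    covers′ r q ap = covers q (prefix r , short r , ap)
    -- Winning need not be decidable, but the goal ⊥ is ¬¬-stable, so we may assume it is.
    |xs|≮R : ¬ length xs < R
    |xs|≮R |xs|<R = ¬¬-∀-Fin _ (λ i → ¬¬-∀-Fin _ λ S → ¬¬-excluded-middle) λ wins? →
      let open Profiles xs covers′ wins?
          S , S′ , S<S′ , eq = pigeonhole (^-monoʳ-< 2 (s≤s (s≤s z≤n)) |xs|<R) profile
      in <ᶠ-irrefl (profile-injective S S′ eq) S<S′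

*-<-half : ∀ C a P → 0 < P → (2 * C + 1) * a ≤ 2 * P → C * a < P
*-<-half C zero P 0<P _ rewrite *-zeroʳ C = 0<P
*-<-half C a@(suc _) P _ h = *-cancelˡ-< 2 (C * a) P (begin-strict
  2 * (C * a)           ≡⟨ *-assoc 2 C a ⟨
  2 * C * a             <⟨ m<m+n (2 * C * a) (s≤s z≤n) ⟩
  2 * C * a + 1 * a     ≡⟨ *-distribʳ-+ a (2 * C) 1 ⟨
  (2 * C + 1) * a       ≤⟨ h ⟩
  2 * P                 ∎)
  where open ≤-Reasoning

Subexponential⇒<2^ : ∀ {f} → Subexponential f → ∀ C → Σ ℕ λ N → C * f (suc N) < 2 ^ N
Subexponential⇒<2^ {f} sub C with sub 2 1 (2 * C + 1) (s≤s z≤n) (s≤s (s≤s z≤n)) (m≤n+m 1 (2 * C))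
... | N , bound = N , *-<-half C (f (suc N)) (2 ^ N) (m^n>0 2 N) (begin
  (2 * C + 1) * f (suc N)               ≡⟨ *-identityʳ _ ⟨
  (2 * C + 1) * f (suc N) * 1           ≡⟨ cong ((2 * C + 1) * f (suc N) *_) (^-zeroˡ (suc N)) ⟨
  (2 * C + 1) * f (suc N) * 1 ^ suc N   ≤⟨ bound (suc N) (n≤1+n N) ⟩
  2 * 2 ^ N                             ∎)
  where open ≤-Reasoning

suc[m+n]≡o⇒m<o : ∀ {m n o} → suc (m + n) ≡ o → m < o
suc[m+n]≡o⇒m<o {m} {n} refl = s≤s (m≤m+n m n)

suc[m+n]≡o⇒n<o : ∀ {m n o} → suc (m + n) ≡ o → n < o
suc[m+n]≡o⇒n<o {m} {n} refl = s≤s (m≤n+m n m)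

suc[∸suc+]≡ : ∀ {j h} → j < h → suc (h ∸ suc j + j) ≡ h
suc[∸suc+]≡ {j} {h} j<h = trans (cong suc (+-comm (h ∸ suc j) j)) (m+[n∸m]≡n j<h)

module _ {A : Set} where

  ++-cancel-length : ∀ (xs ys : List A) {as bs} → length xs ≡ length ys → xs ++ as ≡ ys ++ bs → xs ≡ ys
  ++-cancel-length []       []       _   _  = refl
  ++-cancel-length (x ∷ xs) (y ∷ ys) |≡| eq with refl , eq′ ← ∷-injective eq =
    cong (x ∷_) (++-cancel-length xs ys (suc-injective |≡|) eq′)

  ∉-split-unique : ∀ {c : A} xs ys u t → c ∉ xs → c ∉ ys → xs ++ c ∷ ys ≡ u ++ c ∷ t → u ≡ xs × t ≡ ys
  ∉-split-unique []       ys []       t _   _   refl = refl , refl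
  ∉-split-unique []       ys (x ∷ u)  t _   c∉ys refl = ⊥-elim (c∉ys (∈-++⁺ʳ u (here refl)))
  ∉-split-unique (x ∷ xs) ys []       t c∉xs _   refl = ⊥-elim (c∉xs (here refl))
  ∉-split-unique (x ∷ xs) ys (x′ ∷ u) t c∉xs c∉ys eq
    with refl , eq′ ← ∷-injective eq
    with refl , refl ← ∉-split-unique xs ys u t (λ c∈ → c∉xs (there c∈)) c∉ys eq′ = refl , refl

  ∉-split-right : ∀ {c : A} xs bs y t → c ∉ xs → xs ++ bs ≡ y ++ c ∷ t →
                  Σ (List A) λ y′ → y ≡ xs ++ y′ × bs ≡ y′ ++ c ∷ t
  ∉-split-right []       bs y        t _    eq = y , refl , eq
  ∉-split-right (x ∷ xs) bs []       t c∉xs refl = ⊥-elim (c∉xs (here refl))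
  ∉-split-right (x ∷ xs) bs (x′ ∷ y) t c∉xs eq
    with refl , eq′ ← ∷-injective eq
    with y′ , refl , bs≡ ← ∉-split-right xs bs y t (λ c∈ → c∉xs (there c∈)) eq′ = y′ , refl , bs≡

module _ {k : ℕ} where

  letterAt-just⇒< : ∀ (xs : List (Fin k)) {i c} → letterAt xs i ≡ just c → i < length xs
  letterAt-just⇒< (x ∷ xs) {zero}  _  = s≤s z≤n
  letterAt-just⇒< (x ∷ xs) {suc i} eq = s≤s (letterAt-just⇒< xs eq)

  <⇒letterAt-just : ∀ (xs : List (Fin k)) {i} → i < length xs → Σ (Fin k) λ c → letterAt xs i ≡ just c
  <⇒letterAt-just (x ∷ xs) {zero}  _         = x , refl
  <⇒letterAt-just (x ∷ xs) {suc i} (s≤s i<) = <⇒letterAt-just xs i<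

  letterAt-≥ : ∀ (xs : List (Fin k)) {i} → length xs ≤ i → letterAt xs i ≡ nothing
  letterAt-≥ []       _          = refl
  letterAt-≥ (x ∷ xs) {suc i} (s≤s ≤i) = letterAt-≥ xs ≤i

  letterAt-++ˡ : ∀ (xs ys : List (Fin k)) {i} → i < length xs → letterAt (xs ++ ys) i ≡ letterAt xs i
  letterAt-++ˡ (x ∷ xs) ys {zero}  _         = refl
  letterAt-++ˡ (x ∷ xs) ys {suc i} (s≤s i<) = letterAt-++ˡ xs ys i<

  letterAt-++ʳ : ∀ (xs ys : List (Fin k)) i → letterAt (xs ++ ys) (length xs + i) ≡ letterAt ys i
  letterAt-++ʳ []       ys i = refl
  letterAt-++ʳ (x ∷ xs) ys i = letterAt-++ʳ xs ys i

  letterAt-++-length : ∀ (xs ys : List (Fin k)) → letterAt (xs ++ ys) (length xs) ≡ letterAt ys 0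
  letterAt-++-length xs ys = trans (cong (letterAt (xs ++ ys)) (sym (+-identityʳ (length xs))))
                                   (letterAt-++ʳ xs ys 0)

  letterAt-reverse : ∀ (xs : List (Fin k)) i j → suc (i + j) ≡ length xs →
                     letterAt (reverse xs) j ≡ letterAt xs i
  letterAt-reverse (x ∷ xs) zero    j eq = begin
    letterAt (reverse (x ∷ xs)) j            ≡⟨ cong (λ ys → letterAt ys j) (unfold-reverse x xs) ⟩
    letterAt (reverse xs ++ [ x ]) j         ≡⟨ cong (letterAt (reverse xs ++ [ x ])) j≡ ⟩
    letterAt (reverse xs ++ [ x ]) (length (reverse xs)) ≡⟨ letterAt-++-length (reverse xs) [ x ] ⟩
    just x                                   ∎
    where
    open ≡-Reasoning
    j≡ : j ≡ length (reverse xs)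
    j≡ = trans (suc-injective eq) (sym (length-reverse xs))
  letterAt-reverse (x ∷ xs) (suc i) j eq = begin
    letterAt (reverse (x ∷ xs)) j    ≡⟨ cong (λ ys → letterAt ys j) (unfold-reverse x xs) ⟩
    letterAt (reverse xs ++ [ x ]) j ≡⟨ letterAt-++ˡ (reverse xs) [ x ] j< ⟩
    letterAt (reverse xs) j          ≡⟨ letterAt-reverse xs i j (suc-injective eq) ⟩
    letterAt xs i                    ∎
    where
    open ≡-Reasoning
    j< : j < length (reverse xs)
    j< = subst (j <_) (sym (trans (length-reverse xs) (sym (suc-injective eq)))) (s≤s (m≤n+m j i))

  letterAt-take : ∀ n (xs : List (Fin k)) {i} → i < n → letterAt (take n xs) i ≡ letterAt xs i
  letterAt-take (suc n) []       _          = refl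
  letterAt-take (suc n) (x ∷ xs) {zero}  _  = refl
  letterAt-take (suc n) (x ∷ xs) {suc i} (s≤s i<) = letterAt-take n xs i<

  letterAt-take-≥ : ∀ n (xs : List (Fin k)) {i} → n ≤ i → letterAt (take n xs) i ≡ nothing
  letterAt-take-≥ zero    xs       _ = refl
  letterAt-take-≥ (suc n) []       _ = refl
  letterAt-take-≥ (suc n) (x ∷ xs) {suc i} (s≤s ≤i) = letterAt-take-≥ n xs ≤i

  letterAt-drop : ∀ n (xs : List (Fin k)) i → letterAt (drop n xs) i ≡ letterAt xs (n + i)
  letterAt-drop zero    xs       i = refl
  letterAt-drop (suc n) []       i = refl
  letterAt-drop (suc n) (x ∷ xs) i = letterAt-drop n xs i

  drop-letterAt : ∀ (xs : List (Fin k)) i {c} → letterAt xs i ≡ just c → drop i xs ≡ c ∷ drop (suc i) xs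
  drop-letterAt (x ∷ xs) zero    refl = refl
  drop-letterAt (x ∷ xs) (suc i) eq   = drop-letterAt xs i eq

  letterAt-ext : ∀ (xs ys : List (Fin k)) → (∀ i → letterAt xs i ≡ letterAt ys i) → xs ≡ ys
  letterAt-ext []       []       _  = refl
  letterAt-ext []       (y ∷ ys) eq with () ← eq 0
  letterAt-ext (x ∷ xs) []       eq with () ← eq 0
  letterAt-ext (x ∷ xs) (y ∷ ys) eq =
    cong₂ _∷_ (just-injective (eq 0)) (letterAt-ext xs ys (λ i → eq (suc i)))

-- The language and the lower bound

Letter : Set
Letter = Fin 4

hash dollar : Letter
hash   = suc (suc zero)
dollar = suc (suc (suc zero))

Mirror : Language 4
Mirror w = Σ (List Letter) λ u → Σ (List Letter) λ y → Σ (List Letter) λ z →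
  w ≡ u ++ hash ∷ y ++ dollar ∷ reverse u ++ z

bit : Fin 2 → Letter
bit zero       = zero
bit (suc zero) = suc zero

bits : ∀ {m} → (Fin m → Fin 2) → List Letter
bits {zero}  f = []
bits {suc m} f = bit (f zero) ∷ bits (λ i → f (suc i))

length-bits : ∀ {m} (f : Fin m → Fin 2) → length (bits f) ≡ m
length-bits {zero}  f = refl
length-bits {suc m} f = cong suc (length-bits (λ i → f (suc i)))

bit-injective : ∀ i j → bit i ≡ bit j → i ≡ j
bit-injective zero       zero       _ = refl
bit-injective (suc zero) (suc zero) _ = refl
bit-injective zero       (suc zero) ()
bit-injective (suc zero) zero       ()

bits-injective : ∀ {m} (f g : Fin m → Fin 2) → bits f ≡ bits g → ∀ i → f i ≡ g i
bits-injective f g eq zero    = bit-injective _ _ (proj₁ (∷-injective eq))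
bits-injective f g eq (suc i) =
  bits-injective (λ i → f (suc i)) (λ i → g (suc i)) (proj₂ (∷-injective eq)) i

bits-∌ : ∀ {m c} (f : Fin m → Fin 2) → (∀ i → c ≢ bit i) → c ∉ bits f
bits-∌ {suc m} f c≢bit (here c≡)  = c≢bit (f zero) c≡
bits-∌ {suc m} f c≢bit (there c∈) = bits-∌ (λ i → f (suc i)) c≢bit c∈

hash≢bit : ∀ i → hash ≢ bit i
hash≢bit zero       ()
hash≢bit (suc zero) ()

dollar≢bit : ∀ i → dollar ≢ bit i
dollar≢bit zero       ()
dollar≢bit (suc zero) ()

encode : ∀ N → Fin (2 ^ N) → List Letter
encode N r = bits (finToFun {2} {N} r)

length-encode : ∀ N r → length (encode N r) ≡ N
length-encode N r = length-bits (finToFun {2} {N} r)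

encode-injective : ∀ N r r′ → encode N r ≡ encode N r′ → r ≡ r′
encode-injective N r r′ eq = finToFun-injective r r′ (bits-injective _ _ eq)

mirrorBlocks : List (List Letter) → List Letter
mirrorBlocks []       = []
mirrorBlocks (b ∷ bs) = dollar ∷ reverse b ++ mirrorBlocks bs

mirrorBlocks-∈ : ∀ {b bs} → b ∈ bs →
                 Σ (List Letter) λ pre → Σ (List Letter) λ post →
                   mirrorBlocks bs ≡ pre ++ dollar ∷ reverse b ++ post
mirrorBlocks-∈ {bs = b ∷ bs} (here refl) = [] , mirrorBlocks bs , refl
mirrorBlocks-∈ {bs = b′ ∷ bs} (there b∈) with pre , post , eq ← mirrorBlocks-∈ b∈ =
  dollar ∷ reverse b′ ++ pre , post ,
  cong (λ t → dollar ∷ t) (trans (cong (reverse b′ ++_) eq) (sym (++-assoc (reverse b′) pre _)))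

hash∉mirrorBlocks : ∀ bs → (∀ {b} → b ∈ bs → hash ∉ b) → hash ∉ mirrorBlocks bs
hash∉mirrorBlocks (b ∷ bs) hash∉ (there hash∈) with ∈-++⁻ (reverse b) hash∈
... | inj₁ hash∈b = hash∉ (here refl) (reverse⁻ hash∈b)
... | inj₂ hash∈bs = hash∉mirrorBlocks bs (λ b∈ → hash∉ (there b∈)) hash∈bs

mirrorBlocks-after-dollar : ∀ bs y t → (∀ {b} → b ∈ bs → dollar ∉ b) →
                            mirrorBlocks bs ≡ y ++ dollar ∷ t →
                            Σ (List Letter) λ b → b ∈ bs × Σ (List Letter) λ rest → t ≡ reverse b ++ rest
mirrorBlocks-after-dollar (b ∷ bs) []      t _       eq =
  b , here refl , mirrorBlocks bs , sym (proj₂ (∷-injective eq))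
mirrorBlocks-after-dollar (b ∷ bs) (_ ∷ y) t dollar∉ eq
  with refl , eq′ ← ∷-injective eq
  with y′ , _ , eq″ ← ∉-split-right (reverse b) _ y t (λ d∈ → dollar∉ (here refl) (reverse⁻ d∈)) eq′
  with b′ , b′∈ , rest , t≡ ← mirrorBlocks-after-dollar bs y′ t (λ b∈ → dollar∉ (there b∈)) eq″ =
  b′ , there b′∈ , rest , t≡

module MirrorFoolingSet (N : ℕ) where
  open Equivalence

  R : ℕ
  R = 2 ^ N

  member? : ∀ S r → Dec (finToFun {2} {R} S r ≡ suc zero)
  member? S r = finToFun S r ≟ᶠ suc zero

  selected : Fin (2 ^ R) → List (Fin R)
  selected S = filter (member? S) (allFin R)

  prefix : Fin R → List Letter
  prefix r = encode N r ++ [ hash ]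

  selectedCodes : Fin (2 ^ R) → List (List Letter)
  selectedCodes S = map (encode N) (selected S)

  suffix : Fin (2 ^ R) → List Letter
  suffix S = mirrorBlocks (selectedCodes S)

  length-prefix : ∀ r → length (prefix r) ≤ suc N
  length-prefix r = ≤-reflexive (begin
    length (encode N r ++ [ hash ]) ≡⟨ length-++ (encode N r) ⟩
    length (encode N r) + 1         ≡⟨ cong (_+ 1) (length-encode N r) ⟩
    N + 1                           ≡⟨ +-comm N 1 ⟩
    suc N                           ∎)
    where open ≡-Reasoning

  encodings-∌ : ∀ {c} S → (∀ i → c ≢ bit i) → ∀ {b} → b ∈ selectedCodes S → c ∉ b
  encodings-∌ S c≢bit b∈ with _ , _ , refl ← ∈-map⁻ (encode N) b∈ = bits-∌ _ c≢bit

  prefix-++-suffix : ∀ r S → prefix r ++ suffix S ≡ encode N r ++ hash ∷ suffix S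
  prefix-++-suffix r S = ++-assoc (encode N r) [ hash ] (suffix S)

  separates-← : ∀ r S → finToFun S r ≡ suc zero → Mirror (prefix r ++ suffix S)
  separates-← r S r∈S
    with pre , post , eq ← mirrorBlocks-∈ (∈-map⁺ (encode N) (∈-filter⁺ (member? S) (∈-allFin r) r∈S)) =
    encode N r , pre , post , trans (prefix-++-suffix r S) (cong (λ t → encode N r ++ hash ∷ t) eq)

  separates-→ : ∀ r S → Mirror (prefix r ++ suffix S) → finToFun S r ≡ suc zero
  separates-→ r S (u , y , z , eq)
    with refl , eq′ ← ∉-split-unique (encode N r) (suffix S) u (y ++ dollar ∷ reverse u ++ z)
                        (bits-∌ (finToFun {2} {N} r) hash≢bit)
                        (hash∉mirrorBlocks (selectedCodes S) (encodings-∌ S hash≢bit))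
                        (trans (sym (prefix-++-suffix r S)) eq)
    with b , b∈ , rest , eq″ ← mirrorBlocks-after-dollar (selectedCodes S) y (reverse u ++ z)
                                 (encodings-∌ S dollar≢bit) (sym eq′)
    with r′ , r′∈ , refl ← ∈-map⁻ (encode N) b∈
    with _ , r′∈S ← ∈-filter⁻ (member? S) {xs = allFin R} r′∈ =
    subst (λ x → finToFun S x ≡ suc zero) (sym r≡r′) r′∈S
    where
    |r|≡|r′| : length (reverse (encode N r)) ≡ length (reverse (encode N r′))
    |r|≡|r′| = trans (length-reverse (encode N r)) (trans (length-encode N r)
                 (sym (trans (length-reverse (encode N r′)) (length-encode N r′))))
    r≡r′ : r ≡ r′
    r≡r′ = encode-injective N r r′ (reverse-injective
             (++-cancel-length (reverse (encode N r)) (reverse (encode N r′)) |r|≡|r′| eq″))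

  separates : ∀ r S → Mirror (prefix r ++ suffix S) ⇔ finToFun S r ≡ suc zero
  separates r S = mk⇔ (separates-→ r S) (separates-← r S)

Mirror-∉-Alt : ∀ f → Subexponential f → ¬ InAlt f Mirror
Mirror-∉-Alt f sub (M , recognises , C , bound) with N , Cf<2^N ← Subexponential⇒<2^ sub C =
  <⇒≱ Cf<2^N (fooling-set-bound M recognises prefix suffix separates length-prefix (bound (suc N)))
  where open MirrorFoolingSet N

-- Context-freeness

initial core free : Fin 3
initial = zero
core  = suc zero
free  = suc (suc zero)

Rule : Set
Rule = Fin 3 × List (Fin 3 ⊎ Letter)

coreRule freeRule : Letter → Rule
coreRule c = core , inj₂ c ∷ inj₁ core ∷ inj₂ c ∷ []
freeRule c = free , inj₂ c ∷ inj₁ free ∷ []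

-- initial → core free,  core → # free $ | c core c,  free → ε | c free
mirrorRules : List Rule
mirrorRules =
  (initial , inj₁ core ∷ inj₁ free ∷ []) ∷
  (core , inj₂ hash ∷ inj₁ free ∷ inj₂ dollar ∷ []) ∷
  (free , []) ∷
  map coreRule (allFin 4) ++ map freeRule (allFin 4)

mirrorGrammar : CFG 4
mirrorGrammar = record { nonterminals = 3 ; startSymbol = initial ; rules = mirrorRules }

coreRule∈ : ∀ c → coreRule c ∈ mirrorRules
coreRule∈ c = there (there (there (∈-++⁺ˡ (∈-map⁺ coreRule (∈-allFin c)))))

freeRule∈ : ∀ c → freeRule c ∈ mirrorRules
freeRule∈ c = there (there (there (∈-++⁺ʳ (map coreRule (allFin 4)) (∈-map⁺ freeRule (∈-allFin c)))))

mirror-++-assoc : ∀ u y v z → (u ++ hash ∷ y ++ dollar ∷ v) ++ z ≡ u ++ hash ∷ y ++ dollar ∷ v ++ z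
mirror-++-assoc u y v z = trans (++-assoc u _ z) (cong (λ t → u ++ hash ∷ t) (++-assoc y _ z))

mirror-wrap : ∀ c u y → c ∷ (u ++ hash ∷ y ++ dollar ∷ reverse u) ++ [ c ] ≡
                        (c ∷ u) ++ hash ∷ y ++ dollar ∷ reverse (c ∷ u)
mirror-wrap c u y = cong (c ∷_) (trans (mirror-++-assoc u y (reverse u) [ c ])
  (cong (λ t → u ++ hash ∷ y ++ dollar ∷ t) (sym (unfold-reverse c u))))

free-complete : ∀ y → Derives mirrorGrammar (inj₁ free) y
free-complete []      = rule (there (there (here refl))) []
free-complete (c ∷ y) = subst (λ t → Derives mirrorGrammar (inj₁ free) (c ∷ t)) (++-identityʳ y)
  (rule (freeRule∈ c) (terminal c ∷ (free-complete y ∷ [])))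

core-complete : ∀ u y → Derives mirrorGrammar (inj₁ core) (u ++ hash ∷ y ++ dollar ∷ reverse u)
core-complete []      y = rule (there (here refl)) (terminal hash ∷ (free-complete y ∷ (terminal dollar ∷ [])))
core-complete (c ∷ u) y = subst (Derives mirrorGrammar (inj₁ core)) (mirror-wrap c u y)
  (rule (coreRule∈ c) (terminal c ∷ (core-complete u y ∷ (terminal c ∷ []))))

core-sound : ∀ {x} → Derives mirrorGrammar (inj₁ core) x →
             Σ (List Letter) λ u → Σ (List Letter) λ y → x ≡ u ++ hash ∷ y ++ dollar ∷ reverse u
core-sound (rule (here ()) _)
core-sound (rule (there (here refl)) (terminal _ ∷ (_∷_ {u = y} _ (terminal _ ∷ [])))) = [] , y , refl
core-sound (rule (there (there (here ()))) _)
core-sound (rule (there (there (there r∈))) ds) with ∈-++⁻ (map coreRule (allFin 4)) r∈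
... | inj₂ r∈′ with _ , _ , () ← ∈-map⁻ freeRule r∈′
... | inj₁ r∈′ with c , _ , refl ← ∈-map⁻ coreRule r∈′
               with terminal _ ∷ (d ∷ (terminal _ ∷ [])) ← ds
               with u , y , refl ← core-sound d = c ∷ u , y , mirror-wrap c u y

initial-sound : ∀ {w} → Generates mirrorGrammar w → Mirror w
initial-sound (rule (here refl) (d ∷ (_∷_ {u = z} _ []))) with u , y , refl ← core-sound d =
  u , y , z , trans (cong (_ ++_) (++-identityʳ z)) (mirror-++-assoc u y (reverse u) z)
initial-sound (rule (there (here ())) _)
initial-sound (rule (there (there (here ()))) _)
initial-sound (rule (there (there (there r∈))) _) with ∈-++⁻ (map coreRule (allFin 4)) r∈
... | inj₁ r∈′ with _ , _ , () ← ∈-map⁻ coreRule r∈′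
... | inj₂ r∈′ with _ , _ , () ← ∈-map⁻ freeRule r∈′

initial-complete : ∀ {w} → Mirror w → Generates mirrorGrammar w
initial-complete (u , y , z , refl) =
  subst (Generates mirrorGrammar)
    (trans (cong (_ ++_) (++-identityʳ z)) (mirror-++-assoc u y (reverse u) z))
    (rule (here refl) (core-complete u y ∷ (free-complete z ∷ [])))

Mirror-contextFree : ContextFree Mirror
Mirror-contextFree = mirrorGrammar , λ w → mk⇔ initial-complete initial-sound

-- Presburger definability

mirror-offset : ∀ d i j → suc (d + j) + i ≡ d + suc (i + j)
mirror-offset = solve-∀

record MirrorPositions (w : List Letter) : Set where
  field
    h d       : ℕ
    h<d       : h < d
    hash-at   : letterAt w h ≡ just hash
    dollar-at : letterAt w d ≡ just dollar
    reflected : ∀ i j → suc (i + j) ≡ h → letterAt w (suc (d + j)) ≡ letterAt w i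

Mirror⇒MirrorPositions : ∀ {w} → Mirror w → MirrorPositions w
Mirror⇒MirrorPositions (u , y , z , refl) = record
  { h         = length u
  ; d         = length u + suc (length y)
  ; h<d       = m<m+n (length u) (s≤s z≤n)
  ; hash-at   = letterAt-++-length u _
  ; dollar-at = trans (letterAt-++ʳ u _ (suc (length y))) (letterAt-++-length y _)
  ; reflected = reflected
  }
  where
  reflected : ∀ i j → suc (i + j) ≡ length u →
              letterAt (u ++ hash ∷ y ++ dollar ∷ reverse u ++ z) (suc (length u + suc (length y) + j)) ≡
              letterAt (u ++ hash ∷ y ++ dollar ∷ reverse u ++ z) i
  reflected i j eq = begin
    letterAt (u ++ _) (suc (length u + suc (length y) + j))   ≡⟨ cong (letterAt (u ++ _)) offset ⟩
    letterAt (u ++ _) (length u + suc (length y + suc j))     ≡⟨ letterAt-++ʳ u _ _ ⟩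
    letterAt (y ++ dollar ∷ reverse u ++ z) (length y + suc j) ≡⟨ letterAt-++ʳ y _ (suc j) ⟩
    letterAt (reverse u ++ z) j                               ≡⟨ letterAt-++ˡ (reverse u) z j<|u| ⟩
    letterAt (reverse u) j                                    ≡⟨ letterAt-reverse u i j eq ⟩
    letterAt u i                                              ≡⟨ letterAt-++ˡ u _ i<|u| ⟨
    letterAt (u ++ _) i                                       ∎
    where
    open ≡-Reasoning
    offset : suc (length u + suc (length y) + j) ≡ length u + suc (length y + suc j)
    offset = trans (sym (+-suc _ j)) (+-assoc (length u) (suc (length y)) (suc j))
    j<|u| : j < length (reverse u)
    j<|u| = suc[m+n]≡o⇒n<o (trans eq (sym (length-reverse u)))
    i<|u| : i < length u
    i<|u| = suc[m+n]≡o⇒m<o eq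

MirrorPositions⇒Mirror : ∀ {w} → MirrorPositions w → Mirror w
MirrorPositions⇒Mirror {w} pos = u , y , z , w≡
  where
  open MirrorPositions pos
  u y z : List Letter
  u = take h w
  y = take (d ∸ suc h) (drop (suc h) w)
  z = drop (suc (d + h)) w

  |u|≡h : length u ≡ h
  |u|≡h = trans (length-take h w) (m≤n⇒m⊓n≡m (<⇒≤ (letterAt-just⇒< w hash-at)))

  after-hash : drop (suc h) w ≡ y ++ drop d w
  after-hash = trans (sym (take++drop≡id (d ∸ suc h) (drop (suc h) w)))
    (cong (y ++_) (trans (drop-drop (suc h) (d ∸ suc h) w) (cong (λ n → drop n w) (m+[n∸m]≡n h<d))))

  after-dollar : drop (suc d) w ≡ take h (drop (suc d) w) ++ z
  after-dollar = trans (sym (take++drop≡id h (drop (suc d) w)))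
    (cong (take h (drop (suc d) w) ++_) (drop-drop (suc d) h w))

  mirrored-at : ∀ j → letterAt (take h (drop (suc d) w)) j ≡ letterAt (reverse u) j
  mirrored-at j with j <? h
  ... | no j≮h = trans (letterAt-take-≥ h _ (≮⇒≥ j≮h))
    (sym (letterAt-≥ (reverse u) (subst (_≤ j) (sym (trans (length-reverse u) |u|≡h)) (≮⇒≥ j≮h))))
  ... | yes j<h = begin
    letterAt (take h (drop (suc d) w)) j ≡⟨ letterAt-take h _ j<h ⟩
    letterAt (drop (suc d) w) j          ≡⟨ letterAt-drop (suc d) w j ⟩
    letterAt w (suc (d + j))             ≡⟨ reflected i j (suc[∸suc+]≡ j<h) ⟩
    letterAt w i                         ≡⟨ letterAt-take h w i<h ⟨
    letterAt u i                         ≡⟨ letterAt-reverse u i j (trans (suc[∸suc+]≡ j<h) (sym |u|≡h)) ⟨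
    letterAt (reverse u) j               ∎
    where
    open ≡-Reasoning
    i : ℕ
    i = h ∸ suc j
    i<h : i < h
    i<h = suc[m+n]≡o⇒m<o (suc[∸suc+]≡ j<h)

  w≡ : w ≡ u ++ hash ∷ y ++ dollar ∷ reverse u ++ z
  w≡ = begin
    w                                              ≡⟨ take++drop≡id h w ⟨
    u ++ drop h w                                  ≡⟨ cong (u ++_) (drop-letterAt w h hash-at) ⟩
    u ++ hash ∷ drop (suc h) w                     ≡⟨ cong (λ t → u ++ hash ∷ t) after-hash ⟩
    u ++ hash ∷ y ++ drop d w                      ≡⟨ cong (λ t → u ++ hash ∷ y ++ t) (drop-letterAt w d dollar-at) ⟩
    u ++ hash ∷ y ++ dollar ∷ drop (suc d) w       ≡⟨ cong (λ t → u ++ hash ∷ y ++ dollar ∷ t) after-dollar ⟩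
    u ++ hash ∷ y ++ dollar ∷ take h (drop (suc d) w) ++ z
      ≡⟨ cong (λ t → u ++ hash ∷ y ++ dollar ∷ t ++ z) (letterAt-ext _ _ mirrored-at) ⟩
    u ++ hash ∷ y ++ dollar ∷ reverse u ++ z       ∎
    where open ≡-Reasoning

sameLetter : ∀ {v} → Fin v → Fin v → PForm 4 v
sameLetter x y = or (both (# 0)) (or (both (# 1)) (or (both (# 2)) (both (# 3))))
  where
  both : Letter → PForm 4 _
  both a = and (letter a x) (letter a y)

sameLetter-sound : ∀ {v} w (ρ : Fin v → ℕ) x y →
                   Sat w ρ (sameLetter x y) → letterAt w (ρ x) ≡ letterAt w (ρ y)
sameLetter-sound w ρ x y (inj₁ (a , b))                = trans a (sym b)
sameLetter-sound w ρ x y (inj₂ (inj₁ (a , b)))         = trans a (sym b)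
sameLetter-sound w ρ x y (inj₂ (inj₂ (inj₁ (a , b))))  = trans a (sym b)
sameLetter-sound w ρ x y (inj₂ (inj₂ (inj₂ (a , b))))  = trans a (sym b)

sameLetter-complete : ∀ {v} w (ρ : Fin v → ℕ) x y {c} →
                      letterAt w (ρ x) ≡ just c → letterAt w (ρ y) ≡ just c → Sat w ρ (sameLetter x y)
sameLetter-complete w ρ x y {zero}                   a b = inj₁ (a , b)
sameLetter-complete w ρ x y {suc zero}               a b = inj₂ (inj₁ (a , b))
sameLetter-complete w ρ x y {suc (suc zero)}         a b = inj₂ (inj₂ (inj₁ (a , b)))
sameLetter-complete w ρ x y {suc (suc (suc zero))}   a b = inj₂ (inj₂ (inj₂ (a , b)))

-- ∃h ∃d ∃s. #(h) ∧ $(d) ∧ h < d ∧ d + h = s ∧ ∀i. ¬ i < h ∨ ∃t. t + i = s ∧ w[i] = w[t],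
-- the variable bound innermost being # 0.
mirrorFormula : PForm 4 0
mirrorFormula =
  exists (exists (exists (
    and (letter hash (# 2)) (and (letter dollar (# 1)) (and (less (# 2) (# 1)) (and (plus (# 1) (# 2) (# 0))
      (all (or (neg (less (# 0) (# 3)))
               (exists (and (plus (# 0) (# 1) (# 2)) (sameLetter (# 1) (# 0))))))))))))

Sat⇒MirrorPositions : ∀ {w} → Sat w noVars mirrorFormula → MirrorPositions w
Sat⇒MirrorPositions {w} (h , h<|w| , d , _ , _ , _ , hash-at , dollar-at , h<d , refl , mirrored) = record
  { h = h ; d = d ; h<d = h<d ; hash-at = hash-at ; dollar-at = dollar-at ; reflected = reflected }
  where
  reflected : ∀ i j → suc (i + j) ≡ h → letterAt w (suc (d + j)) ≡ letterAt w i
  reflected i j eq with mirrored i (<-trans (suc[m+n]≡o⇒m<o eq) h<|w|)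
  ... | inj₁ i≮h = contradiction (suc[m+n]≡o⇒m<o eq) i≮h
  ... | inj₂ (t , _ , t+i≡ , same) =
    trans (cong (letterAt w) (sym t≡))
          (sym (sameLetter-sound w (t ∷ᵥ i ∷ᵥ (d + h) ∷ᵥ d ∷ᵥ h ∷ᵥ noVars) (# 1) (# 0) same))
    where
    t≡ : t ≡ suc (d + j)
    t≡ = +-cancelʳ-≡ i t (suc (d + j))
           (trans t+i≡ (trans (cong (d +_) (sym eq)) (sym (mirror-offset d i j))))

MirrorPositions⇒Sat : ∀ {w} → MirrorPositions w → Sat w noVars mirrorFormula
MirrorPositions⇒Sat {w} pos =
  h , h<|w| , d , letterAt-just⇒< w dollar-at , d + h , d+h<|w| h refl ,
  hash-at , dollar-at , h<d , refl , mirrored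
  where
  open MirrorPositions pos
  h<|w| : h < length w
  h<|w| = letterAt-just⇒< w hash-at

  d+h<|w| : ∀ h′ → h′ ≡ h → d + h′ < length w
  d+h<|w| zero     _  = subst (_< length w) (sym (+-identityʳ d)) (letterAt-just⇒< w dollar-at)
  d+h<|w| (suc h′) eq with c , w₀≡c ← <⇒letterAt-just w (≤-<-trans z≤n h<|w|) =
    subst (_< length w) (sym (+-suc d h′)) (letterAt-just⇒< w (trans (reflected 0 h′ eq) w₀≡c))

  mirrored : ∀ i → i < length w → (¬ i < h) ⊎ Σ ℕ λ t → t < length w × t + i ≡ d + h ×
             Sat w (t ∷ᵥ i ∷ᵥ (d + h) ∷ᵥ d ∷ᵥ h ∷ᵥ noVars) (sameLetter (# 1) (# 0))
  mirrored i i<|w| with i <? h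
  ... | no i≮h = inj₁ i≮h
  ... | yes i<h with c , wᵢ≡c ← <⇒letterAt-just w i<|w| =
    inj₂ (suc (d + j) , letterAt-just⇒< w wₜ≡c , t+i≡ ,
          sameLetter-complete w (suc (d + j) ∷ᵥ i ∷ᵥ (d + h) ∷ᵥ d ∷ᵥ h ∷ᵥ noVars) (# 1) (# 0) wᵢ≡c wₜ≡c)
    where
    j : ℕ
    j = h ∸ suc i
    i+j : suc (i + j) ≡ h
    i+j = m+[n∸m]≡n i<h
    wₜ≡c : letterAt w (suc (d + j)) ≡ just c
    wₜ≡c = trans (reflected i j i+j) wᵢ≡c
    t+i≡ : suc (d + j) + i ≡ d + h
    t+i≡ = trans (mirror-offset d i j) (cong (d +_) i+j)

Mirror-presburgerDefinable : PresburgerDefinable Mirror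
Mirror-presburgerDefinable = mirrorFormula , λ w →
  mk⇔ (MirrorPositions⇒Sat ∘ Mirror⇒MirrorPositions) (MirrorPositions⇒Mirror ∘ Sat⇒MirrorPositions)

theorem4 : Σ ℕ λ k → Σ (Language k) λ L →
    ContextFree L × PresburgerDefinable L ×
    (∀ (f : ℕ → ℕ) → Subexponential f → ¬ InAlt f L)
theorem4 = 4 , Mirror , Mirror-contextFree , Mirror-presburgerDefinable , Mirror-∉-Alt
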